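{- Let $n, r, d$ be positive integers with $n\geqslant r+1$ and $d\geqslant 2$. Then $\mathcal{C}_r^d$ is a percolating set of $K_n^d$ in the $r$-neighbor bootstrap percolation process.
   Context: All graphs are finite, simple and undirected. For an integer $r\geqslant 0$ and a graph $G$, the $r$-neighbor bootstrap percolation process on $G$ starts with a set $A_0\subseteq V(G)$ of initially active vertices, and for $i\geqslant 1$, $A_i=A_{i-1}\cup\{v\in V(G): |N(v)\cap A_{i-1}|\geqslant r\}$, where $N(v)$ is the set of neighbors of $v$; $A_0$ is a percolating set if $\bigcup_{i\geqslant 0}A_i=V(G)$. $K_n^d$ is the Cartesian product of $d$ copies of $K_n$: vertex set $[\![n]\!]^d$ where $[\![n]\!]=\{0,1,\ldots,n-1\}$, two vertices adjacent iff they differ in exactly one coordinate. Let $\delta=(d-2)/(d-1)$. For $t=(t_1,\ldots,t_d)\in\{0,1\}^d$ and $P\subseteq[\![n]\!]^d$, let $P(t)$ be the set of $(x_1,\ldots,x_d)\in[\![n]\!]^d$ for which there exists $(p_1,\ldots,p_d)\in P$ with $x_i=t_i(n-1-p_i)+(1-t_i)p_i$ for all $i$. Let $A_r^d=\{(x_1,\ldots,x_d)\in[\![n]\!]^d : \sum_{i=1}^d x_i\leqslant\lceil r/2\rceil-1\}$, $B_r^d=\{(x_1,\ldots,x_d)\in[\![n]\!]^d : x_1+x_2+\delta\sum_{i=3}^d x_i<\delta(\lceil r/2\rceil-1)\}$, $C_r^d=A_r^d\setminus B_r^d$, $T=\{(t_1,\ldots,t_d)\in\{0,1\}^d : t_1=t_2\}$,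 and $\mathcal{C}_r^d=\bigcup_{t\in T}C_r^d(t)$. -}

module Defs where

open import Data.Nat using (ℕ; zero; suc; _+_; _*_; _∸_; _≤_; _<_; _/_)
open import Data.Nat.Properties using (_<?_)
open import Data.Fin using (Fin; toℕ)
open import Data.Bool using (Bool; true; false)
open import Data.Product using (Σ; ∃; _×_; _,_)
open import Data.Sum using (_⊎_)
open import Relation.Nullary using (¬_; yes; no)
open import Relation.Binary.PropositionalEquality using (_≡_; _≢_)
open import Function.Definitions using (Injective)

-- Vertices of K_n^d : [[n]]^d, coordinates indexed by Fin d
-- (index with toℕ = k corresponds to the paper's coordinate k+1).
Vertex : ℕ → ℕ → Set
Vertex n d = Fin d → Fin n

Adj : ∀ {n d} → Vertex n d → Vertex n d → Set
Adj {n} {d} x y = Σ (Fin d) λ k → (x k ≢ y k) × (∀ j → j ≢ k → x j ≡ y j)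

VSet : ℕ → ℕ → Set₁
VSet n d = Vertex n d → Set

-- |N(v) ∩ A| ≥ r : there are r pairwise distinct neighbours of v in A.
AtLeastNbrs : ∀ {n d} → ℕ → VSet n d → Vertex n d → Set
AtLeastNbrs {n} {d} r A v =
  Σ (Fin r → Vertex n d) λ f → Injective _≡_ _≡_ f × (∀ j → Adj v (f j) × A (f j))

Active : ∀ {n d} → ℕ → VSet n d → ℕ → VSet n d
Active r A₀ zero v = A₀ v
Active r A₀ (suc i) v = Active r A₀ i v ⊎ AtLeastNbrs r (Active r A₀ i) v

Percolates : ∀ {n d} → ℕ → VSet n d → Set
Percolates {n} {d} r A₀ = ∀ (v : Vertex n d) → ∃ λ i → Active r A₀ i v

sumFin : (d : ℕ) → (Fin d → ℕ) → ℕ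
sumFin zero f = 0
sumFin (suc d) f = f Fin.zero + sumFin d (λ i → f (Fin.suc i))

firstTwo : ∀ {n d} → Vertex n d → ℕ
firstTwo {n} {d} x = sumFin d λ i → sel (toℕ i <? 2) (toℕ (x i))
  where
  sel : ∀ {P : Set} → Relation.Nullary.Dec P → ℕ → ℕ
  sel (yes _) m = m
  sel (no _) m = 0

rest : ∀ {n d} → Vertex n d → ℕ
rest {n} {d} x = sumFin d λ i → sel (toℕ i <? 2) (toℕ (x i))
  where
  sel : ∀ {P : Set} → Relation.Nullary.Dec P → ℕ → ℕ
  sel (yes _) m = 0
  sel (no _) m = m

-- ⌈r/2⌉ - 1
c : ℕ → ℕ
c r = ((r + 1) / 2) ∸ 1

Aset : ∀ {n d} → ℕ → VSet n d
Aset {n} {d} r x = sumFin d (λ i → toℕ (x i)) ≤ c r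

-- B_r^d : x₁ + x₂ + δ Σ_{i≥3} x_i < δ (⌈r/2⌉ - 1), δ = (d-2)/(d-1),
-- with the (positive, as d ≥ 2) denominator d-1 cleared.
Bset : ∀ {n d} → ℕ → VSet n d
Bset {n} {d} r x = (d ∸ 1) * firstTwo x + (d ∸ 2) * rest x < (d ∸ 2) * c r

Cset : ∀ {n d} → ℕ → VSet n d
Cset r x = Aset r x × ¬ Bset r x

-- P(t): images of P under reflecting coordinates i with t_i = 1
reflectCoord : ℕ → Bool → ℕ → ℕ
reflectCoord n true p = n ∸ 1 ∸ p
reflectCoord n false p = p

Image : ∀ {n d} → VSet n d → (Fin d → Bool) → VSet n d
Image {n} {d} P t x = Σ (Vertex n d) λ p → P p × (∀ i → toℕ (x i) ≡ reflectCoord n (t i) (toℕ (p i)))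

InT : ∀ {d} → (Fin d → Bool) → Set
InT {d} t = ∀ (i j : Fin d) → toℕ i ≡ 0 → toℕ j ≡ 1 → t i ≡ t j

CalC : ∀ {n d} → ℕ → VSet n d
CalC {n} {d} r x = Σ (Fin d → Bool) λ t → InT t × Image (Cset r) t x

module Submission where

-- Write n = n' + 1, d = d' + 2 and k = ⌈r/2⌉ - 1, so r ≤ 2k + 2 and 2k < n'.  A coordinate
-- a ∈ {0, …, n'} is folded to an orientation (is it read from the far end?) and a folded
-- value min(a, n' - a); a point is aligned when its first two orientations agree (t₁ = t₂).
-- With S the folded head sum x₁ + x₂, R the folded tail sum and tot = S + R, an aligned
-- point with tot ≤ k whose folded point is outside B lies in 𝒞.  Every other point has at
-- least 2k + 2 ≥ r spanned neighbours, each obtained by moving one folded coordinate, and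
-- is spanned by one of three inductions:
--   * aligned, tot ≤ k, inside B: raise a head coordinate or lower a tail coordinate
--     (induction on R + (k - S)), or raise a tail coordinate far enough to leave B;
--   * misaligned, tot ≤ k: lower a coordinate (induction on tot), or move a head coordinate
--     to its partner's orientation, which yields an aligned point;
--   * tot > k: lower a coordinate (induction on tot).

open import Defs
open import Data.Nat using (ℕ; zero; suc; _+_; _*_; _∸_; _≤_; _<_; _≤′_; ≤′-refl; ≤′-step; _⊔_; s≤s; _<ᵇ_; _<?_; _≤?_; _/_; _%_)
open import Data.Nat.Tactic.RingSolver using (solve-∀)
open import Induction.WellFounded using (Acc; acc)
open import Data.Nat.Induction using (<-wellFounded)
open import Data.Nat.DivMod using (m≡m%n+[m/n]*n; m%n<n; m/n*n≤m)
open import Data.Nat.Properties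
open import Algebra.Properties.CommutativeSemigroup +-commutativeSemigroup
  using () renaming (interchange to +-interchange)
open import Data.Fin as Fin using (Fin; toℕ; zero; suc)
import Data.Fin.Properties as Finₚ
open import Data.Bool using (Bool; true; false; not)
open import Data.Bool.Properties as Boolₚ using (not-¬; ¬-not)
open import Data.Product using (Σ; ∃; _×_; _,_; proj₁; proj₂)
open import Data.Sum using (_⊎_; inj₁; inj₂)
open import Data.Empty using (⊥-elim)
open import Data.List using (List; []; _∷_; _++_; map; length; applyUpTo)
open import Data.List.Properties using (length-++; length-map; length-applyUpTo)
open import Data.List.Relation.Unary.All as All using (All; []; _∷_)
import Data.List.Relation.Unary.All.Properties as Allₚ
open import Data.List.Relation.Unary.Unique.Propositional using (Unique; []; _∷_)
import Data.List.Relation.Unary.Unique.Propositional.Properties as Uniqueₚ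
open import Data.List.Relation.Binary.Disjoint.Propositional using (Disjoint)
open import Data.List.Membership.Propositional using (_∈_)
open import Data.List.Membership.Propositional.Properties using (∈-++⁻; ∈-applyUpTo⁻)
open import Data.List.Relation.Unary.Any using (here; there)
open import Data.Vec.Functional using (updateAt)
open import Data.Vec.Functional.Properties using (updateAt-updates; updateAt-minimal)
open import Relation.Nullary using (¬_; yes; no)
open import Relation.Nullary.Reflects using (ofʸ; ofⁿ)
open import Relation.Nullary.Decidable using (dec-true; dec-false)
open import Relation.Binary.PropositionalEquality
open import Function using (id; _∘′_)
open import Function.Definitions using (Injective)

Spanned : ∀ {n d} → ℕ → VSet n d → VSet n d
Spanned r A v = ∃ λ i → Active r A i v

active-mono : ∀ {n d} r (A : VSet n d) v {i j} → i ≤ j → Active r A i v → Active r A j v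
active-mono r A v i≤j = go (≤⇒≤′ i≤j)
  where
  go : ∀ {i j} → i ≤′ j → Active r A i v → Active r A j v
  go ≤′-refl a = a
  go (≤′-step i≤′j) a = inj₁ (go i≤′j a)

common-stage : ∀ {n d} r (A : VSet n d) (L : List (Vertex n d)) →
  All (Spanned r A) L → ∃ λ T → All (Active r A T) L
common-stage r A [] [] = 0 , []
common-stage r A (w ∷ L) ((i , w-active) ∷ spanned) with T , active ← common-stage r A L spanned =
  i ⊔ T , active-mono r A w (m≤m⊔n i T) w-active ∷ All.map (active-mono r A _ (m≤n⊔m i T)) active

distinct-entries : ∀ {A : Set} (L : List A) r → Unique L → r ≤ length L →
  Σ (Fin r → A) λ f → Injective _≡_ _≡_ f × (∀ j → f j ∈ L)
distinct-entries L zero _ _ = (λ ()) , (λ { {()} }) , (λ ())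
distinct-entries (w ∷ L) (suc r) (w∉L ∷ unique) (s≤s r≤)
  with g , g-inj , g∈L ← distinct-entries L r unique r≤ = f , f-inj , f∈
  where
  f : Fin (suc r) → _
  f zero = w
  f (suc j) = g j
  f-inj : Injective _≡_ _≡_ f
  f-inj {zero} {zero} _ = refl
  f-inj {zero} {suc j} w≡gj = ⊥-elim (All.lookup w∉L (g∈L j) w≡gj)
  f-inj {suc i} {zero} gi≡w = ⊥-elim (All.lookup w∉L (g∈L i) (sym gi≡w))
  f-inj {suc i} {suc j} gi≡gj = cong suc (g-inj gi≡gj)
  f∈ : ∀ j → f j ∈ w ∷ L
  f∈ zero = here refl
  f∈ (suc j) = there (g∈L j)

spanned-by-neighbours : ∀ {n d} r (A : VSet n d) x (L : List (Vertex n d)) →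
  Unique L → r ≤ length L → All (Adj x) L → All (Spanned r A) L → Spanned r A x
spanned-by-neighbours r A x L unique r≤ adjacent spanned
  with T , active ← common-stage r A L spanned
  with f , f-inj , f∈L ← distinct-entries L r unique r≤ =
  suc T , inj₂ (f , f-inj , λ j → All.lookup adjacent (f∈L j) , All.lookup active (f∈L j))

concatFin : ∀ {A : Set} m → (Fin m → List A) → List A
concatFin zero G = []
concatFin (suc m) G = G zero ++ concatFin m (λ j → G (suc j))

length-concatFin : ∀ {A : Set} m (G : Fin m → List A) →
  length (concatFin m G) ≡ sumFin m (λ i → length (G i))
length-concatFin zero G = refl
length-concatFin (suc m) G =
  trans (length-++ (G zero)) (cong (length (G zero) +_) (length-concatFin m (λ j → G (suc j))))

∈-concatFin : ∀ {A : Set} m (G : Fin m → List A) {w} → w ∈ concatFin m G → ∃ λ i → w ∈ G i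
∈-concatFin (suc m) G w∈ with ∈-++⁻ (G zero) w∈
... | inj₁ w∈G₀ = zero , w∈G₀
... | inj₂ w∈rest with j , w∈Gj ← ∈-concatFin m (λ j → G (suc j)) w∈rest = suc j , w∈Gj

all-concatFin : ∀ {A : Set} {P : A → Set} m (G : Fin m → List A) →
  (∀ i → All P (G i)) → All P (concatFin m G)
all-concatFin zero G all = []
all-concatFin (suc m) G all = Allₚ.++⁺ (all zero) (all-concatFin m (λ j → G (suc j)) (λ j → all (suc j)))

unique-concatFin : ∀ {A : Set} m (G : Fin m → List A) → (∀ i → Unique (G i)) →
  (∀ {i j} → i ≢ j → Disjoint (G i) (G j)) → Unique (concatFin m G)
unique-concatFin zero G unique disjoint = []
unique-concatFin (suc m) G unique disjoint =
  Uniqueₚ.++⁺ (unique zero)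
    (unique-concatFin m (λ j → G (suc j)) (λ j → unique (suc j))
      (λ i≢j → disjoint (i≢j ∘′ Finₚ.suc-injective)))
    λ (w∈G₀ , w∈rest) → let j , w∈Gj = ∈-concatFin m (λ j → G (suc j)) w∈rest in
      disjoint (λ ()) (w∈G₀ , w∈Gj)

AdjAt : ∀ {n d} → Vertex n d → Fin d → Vertex n d → Set
AdjAt x i w = (x i ≢ w i) × (∀ j → j ≢ i → x j ≡ w j)

-- Neighbours obtained by changing different coordinates are different vertices, so
-- the counts of distinct spanned neighbours along the d coordinates add up.
spanned-by-coordinate-neighbours : ∀ {n d} r (A : VSet n d) x (G : Fin d → List (Vertex n d)) →
  (∀ i → Unique (G i)) → (∀ i → All (AdjAt x i) (G i)) → (∀ i → All (Spanned r A) (G i)) →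
  r ≤ sumFin d (λ i → length (G i)) → Spanned r A x
spanned-by-coordinate-neighbours {d = d} r A x G unique adjacent spanned r≤ =
  spanned-by-neighbours r A x (concatFin d G)
    (unique-concatFin d G unique separated)
    (subst (r ≤_) (sym (length-concatFin d G)) r≤)
    (all-concatFin d G λ i → All.map (i ,_) (adjacent i))
    (all-concatFin d G spanned)
  where
  separated : ∀ {i j} → i ≢ j → Disjoint (G i) (G j)
  separated {i} {j} i≢j (w∈Gi , w∈Gj) =
    proj₁ (All.lookup (adjacent i) w∈Gi) (proj₂ (All.lookup (adjacent j) w∈Gj) i i≢j)

sumFin-cong : ∀ m {g h : Fin m → ℕ} → (∀ i → g i ≡ h i) → sumFin m g ≡ sumFin m h
sumFin-cong zero g≡h = refl
sumFin-cong (suc m) g≡h = cong₂ _+_ (g≡h zero) (sumFin-cong m (λ i → g≡h (suc i)))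

sumFin-+ : ∀ m (g h : Fin m → ℕ) → sumFin m (λ i → g i + h i) ≡ sumFin m g + sumFin m h
sumFin-+ zero g h = refl
sumFin-+ (suc m) g h = trans
  (cong ((g zero + h zero) +_) (sumFin-+ m (λ i → g (suc i)) (λ i → h (suc i))))
  (+-interchange (g zero) (h zero) (sumFin m (λ i → g (suc i))) (sumFin m (λ i → h (suc i))))

sumFin-const : ∀ m a → sumFin m (λ _ → a) ≡ m * a
sumFin-const zero a = refl
sumFin-const (suc m) a = cong (a +_) (sumFin-const m a)

sumFin-shift : ∀ m (g : Fin m → ℕ) a → sumFin m (λ i → g i + a) ≡ sumFin m g + m * a
sumFin-shift m g a = trans (sumFin-+ m g (λ _ → a)) (cong (sumFin m g +_) (sumFin-const m a))

term≤sumFin : ∀ m (g : Fin m → ℕ) i → g i ≤ sumFin m g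
term≤sumFin (suc m) g zero = m≤m+n (g zero) _
term≤sumFin (suc m) g (suc i) = ≤-trans (term≤sumFin m (λ j → g (suc j)) i) (m≤n+m _ (g zero))

sumFin-exchange : ∀ m (g h : Fin m → ℕ) i → (∀ j → j ≢ i → g j ≡ h j) →
  sumFin m g + h i ≡ sumFin m h + g i
sumFin-exchange (suc m) g h zero g≡h = begin
  (g zero + G) + h zero  ≡⟨ cong (λ s → (g zero + s) + h zero) (sumFin-cong m (λ j → g≡h (suc j) (λ ()))) ⟩
  (g zero + H) + h zero  ≡⟨ +-assoc (g zero) H (h zero) ⟩
  g zero + (H + h zero)  ≡⟨ +-comm (g zero) (H + h zero) ⟩
  (H + h zero) + g zero  ≡⟨ cong (_+ g zero) (+-comm H (h zero)) ⟩
  (h zero + H) + g zero  ∎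
  where
  open ≡-Reasoning
  G H : ℕ
  G = sumFin m (λ j → g (suc j))
  H = sumFin m (λ j → h (suc j))
sumFin-exchange (suc m) g h (suc i) g≡h = begin
  (g zero + G) + h (suc i)  ≡⟨ +-assoc (g zero) G (h (suc i)) ⟩
  g zero + (G + h (suc i))  ≡⟨ cong₂ _+_ (g≡h zero (λ ())) tail-exchange ⟩
  h zero + (H + g (suc i))  ≡⟨ +-assoc (h zero) H (g (suc i)) ⟨
  (h zero + H) + g (suc i)  ∎
  where
  open ≡-Reasoning
  G H : ℕ
  G = sumFin m (λ j → g (suc j))
  H = sumFin m (λ j → h (suc j))
  tail-exchange : G + h (suc i) ≡ H + g (suc i)
  tail-exchange = sumFin-exchange m (λ j → g (suc j)) (λ j → h (suc j)) i
    (λ j j≢i → g≡h (suc j) (λ 1+j≡1+i → j≢i (Finₚ.suc-injective 1+j≡1+i)))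

unique-map-on : ∀ {A B : Set} {P : A → Set} (f : A → B) →
  (∀ {a a'} → P a → P a' → f a ≡ f a' → a ≡ a') →
  ∀ {xs} → All P xs → Unique xs → Unique (map f xs)
unique-map-on f f-inj [] [] = []
unique-map-on f f-inj (pa ∷ ps) (a∉ ∷ unique) =
  Allₚ.map⁺ (All.zipWith (λ (pb , a≢b) fa≡fb → a≢b (f-inj pa pb fa≡fb)) (ps , a∉))
  ∷ unique-map-on f f-inj ps unique

-- v as an element of Fin (suc m); values above m are truncated to m.
clamp : (m v : ℕ) → Fin (suc m)
clamp m zero = zero
clamp zero (suc v) = zero
clamp (suc m) (suc v) = suc (clamp m v)

toℕ-clamp : ∀ m {v} → v ≤ m → toℕ (clamp m v) ≡ v
toℕ-clamp m {zero} _ = refl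
toℕ-clamp (suc m) {suc v} (s≤s v≤m) = cong suc (toℕ-clamp m v≤m)

-- The reflection v ↦ n' ∸ v identifies a
-- value a with the pair (orientation a, fold a), fold a = min(a, n' ∸ a) being the
-- distance to the nearer end; pairs whose value lies below the middle are decoded back.
module Folding (n' : ℕ) where

  reflect : Bool → ℕ → ℕ
  reflect = reflectCoord (suc n')

  reflect-≤ : ∀ b {v} → v ≤ n' → reflect b v ≤ n'
  reflect-≤ true {v} _ = m∸n≤m n' v
  reflect-≤ false v≤n' = v≤n'

  reflect-involutive : ∀ b {v} → v ≤ n' → reflect b (reflect b v) ≡ v
  reflect-involutive true v≤n' = m∸[m∸n]≡n v≤n'
  reflect-involutive false _ = refl

  -- true when a lies in the upper half, i.e. is measured from the far end.
  orientation : ℕ → Bool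
  orientation a = n' ∸ a <ᵇ a

  fold : ℕ → ℕ
  fold a = reflect (orientation a) a

  unfold : ∀ {a} → a ≤ n' → reflect (orientation a) (fold a) ≡ a
  unfold {a} = reflect-involutive (orientation a)

  fold-half : ∀ {a} → a ≤ n' → fold a + fold a ≤ n'
  fold-half {a} a≤n' with n' ∸ a <ᵇ a | <ᵇ-reflects-< (n' ∸ a) a
  ... | true | ofʸ n'-a<a = ≤-trans (+-monoʳ-≤ (n' ∸ a) (<⇒≤ n'-a<a)) (≤-reflexive (m∸n+n≡m a≤n'))
  ... | false | ofⁿ n'-a≮a = ≤-trans (+-monoʳ-≤ a (≮⇒≥ n'-a≮a)) (≤-reflexive (m+[n∸m]≡n a≤n'))

  -- Values strictly below the middle; they are recovered from their reflections.
  Small : ℕ → Set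
  Small v = v + v < n'

  small⇒≤ : ∀ {v} → Small v → v ≤ n'
  small⇒≤ {v} small = ≤-trans (m≤m+n v v) (<⇒≤ small)

  small⇒<reflection : ∀ {v} → Small v → v < n' ∸ v
  small⇒<reflection {v} small = m+n≤o⇒m≤o∸n (suc v) small

  orientation-reflect : ∀ b {v} → Small v → orientation (reflect b v) ≡ b
  orientation-reflect false {v} small =
    dec-false (n' ∸ v <? v) (λ n'-v<v → <-asym n'-v<v (small⇒<reflection {v} small))
  orientation-reflect true {v} small = dec-true (n' ∸ (n' ∸ v) <? n' ∸ v)
    (subst (_< n' ∸ v) (sym (m∸[m∸n]≡n (small⇒≤ {v} small))) (small⇒<reflection {v} small))

  fold-reflect : ∀ b {v} → Small v → fold (reflect b v) ≡ v
  fold-reflect b {v} small = trans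
    (cong (λ o → reflect o (reflect b v)) (orientation-reflect b small))
    (reflect-involutive b (small⇒≤ small))

  encode : Bool → ℕ → Fin (suc n')
  encode b v = clamp n' (reflect b v)

  toℕ-encode : ∀ b {v} → Small v → toℕ (encode b v) ≡ reflect b v
  toℕ-encode b small = toℕ-clamp n' (reflect-≤ b (small⇒≤ small))

module Moves (n' d : ℕ) where
  open Folding n' public

  F : Vertex (suc n') d → Fin d → ℕ
  F x i = fold (toℕ (x i))

  O : Vertex (suc n') d → Fin d → Bool
  O x i = orientation (toℕ (x i))

  move : Vertex (suc n') d → Fin d → Bool → ℕ → Vertex (suc n') d
  move x i b v = updateAt x i (λ _ → encode b v)

  move-here : ∀ x i b {v} → Small v → toℕ (move x i b v i) ≡ reflect b v
  move-here x i b small = trans (cong toℕ (updateAt-updates i x)) (toℕ-encode b small)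

  move-elsewhere : ∀ x i b v {j} → j ≢ i → move x i b v j ≡ x j
  move-elsewhere x i b v {j} j≢i = updateAt-minimal j i x j≢i

  F-move : ∀ x i b {v} → Small v → F (move x i b v) i ≡ v
  F-move x i b small = trans (cong fold (move-here x i b small)) (fold-reflect b small)

  O-move : ∀ x i b {v} → Small v → O (move x i b v) i ≡ b
  O-move x i b small = trans (cong orientation (move-here x i b small)) (orientation-reflect b small)

  F-move-elsewhere : ∀ x i b v {j} → j ≢ i → F (move x i b v) j ≡ F x j
  F-move-elsewhere x i b v j≢i = cong (λ a → fold (toℕ a)) (move-elsewhere x i b v j≢i)

  O-move-elsewhere : ∀ x i b v {j} → j ≢ i → O (move x i b v) j ≡ O x j
  O-move-elsewhere x i b v j≢i = cong (λ a → orientation (toℕ a)) (move-elsewhere x i b v j≢i)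

  move-adjacent : ∀ x i b {v} → Small v → (v ≢ F x i ⊎ b ≢ O x i) → AdjAt x i (move x i b v)
  move-adjacent x i b {v} small changed = unchanged-impossible changed , λ j j≢i → sym (move-elsewhere x i b v j≢i)
    where
    unchanged-impossible : v ≢ F x i ⊎ b ≢ O x i → x i ≢ move x i b v i
    unchanged-impossible (inj₁ v≢F) xi≡ =
      v≢F (trans (sym (F-move x i b small)) (cong (λ a → fold (toℕ a)) (sym xi≡)))
    unchanged-impossible (inj₂ b≢O) xi≡ =
      b≢O (trans (sym (O-move x i b small)) (cong (λ a → orientation (toℕ a)) (sym xi≡)))

  module _ (r : ℕ) (A : VSet (suc n') d) where

    KeepMove : Vertex (suc n') d → Fin d → ℕ → Set
    KeepMove x i v = Small v × v ≢ F x i × Spanned r A (move x i (O x i) v)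

    FlipMove : Vertex (suc n') d → Fin d → ℕ → Set
    FlipMove x i v = Small v × Spanned r A (move x i (not (O x i)) v)

    spanned-by-moves : ∀ x (keep flip : Fin d → List ℕ) →
      (∀ i → Unique (keep i)) → (∀ i → Unique (flip i)) →
      (∀ i → All (KeepMove x i) (keep i)) → (∀ i → All (FlipMove x i) (flip i)) →
      r ≤ sumFin d (λ i → length (keep i) + length (flip i)) → Spanned r A x
    spanned-by-moves x keep flip keep-unique flip-unique keep-ok flip-ok r≤ =
      spanned-by-coordinate-neighbours r A x G unique adjacent spanned
        (subst (r ≤_) (sym (sumFin-cong d length-G)) r≤)
      where
      G : Fin d → List (Vertex (suc n') d)
      G i = map (move x i (O x i)) (keep i) ++ map (move x i (not (O x i))) (flip i)

      length-G : ∀ i → length (G i) ≡ length (keep i) + length (flip i)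
      length-G i = trans (length-++ (map (move x i (O x i)) (keep i)))
        (cong₂ _+_ (length-map (move x i (O x i)) (keep i)) (length-map (move x i (not (O x i))) (flip i)))

      injective-on-small : ∀ i b {v v'} → Small v → Small v' → move x i b v ≡ move x i b v' → v ≡ v'
      injective-on-small i b small small' eq =
        trans (sym (F-move x i b small)) (trans (cong (λ y → F y i) eq) (F-move x i b small'))

      oriented : ∀ i b vs → All Small vs → All (λ w → O w i ≡ b) (map (move x i b) vs)
      oriented i b vs smalls = Allₚ.map⁺ (All.map (O-move x i b) smalls)

      keep-small : ∀ i → All Small (keep i)
      keep-small i = All.map proj₁ (keep-ok i)

      flip-small : ∀ i → All Small (flip i)
      flip-small i = All.map proj₁ (flip-ok i)

      unique : ∀ i → Unique (G i)
      unique i = Uniqueₚ.++⁺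
        (unique-map-on _ (injective-on-small i (O x i)) (keep-small i) (keep-unique i))
        (unique-map-on _ (injective-on-small i (not (O x i))) (flip-small i) (flip-unique i))
        λ (w∈keep , w∈flip) → not-¬ (All.lookup (oriented i (O x i) (keep i) (keep-small i)) w∈keep)
                                     (All.lookup (oriented i (not (O x i)) (flip i) (flip-small i)) w∈flip)

      adjacent : ∀ i → All (AdjAt x i) (G i)
      adjacent i = Allₚ.++⁺
        (Allₚ.map⁺ (All.map (λ (small , v≢F , _) → move-adjacent x i (O x i) small (inj₁ v≢F))
                            (keep-ok i)))
        (Allₚ.map⁺ (All.map (λ (small , _) → move-adjacent x i (not (O x i)) small (inj₂ (not-¬ refl ∘′ sym)))
                            (flip-ok i)))

      spanned : ∀ i → All (Spanned r A) (G i)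
      spanned i = Allₚ.++⁺
        (Allₚ.map⁺ (All.map (λ (_ , _ , s) → s) (keep-ok i)))
        (Allₚ.map⁺ (All.map proj₂ (flip-ok i)))

interval : ℕ → ℕ → List ℕ
interval lo l = applyUpTo (lo +_) l

length-interval : ∀ lo l → length (interval lo l) ≡ l
length-interval lo l = length-applyUpTo (lo +_) l

unique-interval : ∀ lo l → Unique (interval lo l)
unique-interval lo l =
  Uniqueₚ.applyUpTo⁺₁ (lo +_) l λ i<j _ lo+i≡lo+j → <⇒≢ i<j (+-cancelˡ-≡ lo _ _ lo+i≡lo+j)

all-interval : ∀ {P : ℕ → Set} lo l → (∀ v → lo ≤ v → v < lo + l → P v) → All P (interval lo l)
all-interval lo l P-ok = Allₚ.applyUpTo⁺₁ (lo +_) l λ {i} i<l → P-ok (lo + i) (m≤m+n lo i) (+-monoʳ-< lo i<l)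

disjoint-intervals : ∀ lo l lo' l' → lo + l ≤ lo' → Disjoint (interval lo l) (interval lo' l')
disjoint-intervals lo l lo' l' lo+l≤lo' (v∈ , v∈')
  with i , i<l , refl ← ∈-applyUpTo⁻ (lo +_) v∈
  with i' , _ , v≡ ← ∈-applyUpTo⁻ (lo' +_) v∈' =
  <⇒≢ (<-≤-trans (+-monoʳ-< lo i<l) (≤-trans lo+l≤lo' (m≤m+n lo' i'))) v≡

quotient-bounds : ∀ S d → 0 < d → ∃ λ q → q * d ≤ S × S < suc q * d
quotient-bounds S (suc d) _ = S / suc d , m/n*n≤m S (suc d) , S<[1+q]d
  where
  S<[1+q]d : S < suc (S / suc d) * suc d
  S<[1+q]d = subst (_< suc (S / suc d) * suc d) (sym (m≡m%n+[m/n]*n S (suc d)))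
    (+-monoˡ-< (S / suc d * suc d) (m%n<n S (suc d)))

c-bounds : ∀ r → 1 ≤ r → r ≤ 2 + (c r + c r) × 2 + (c r + c r) ≤ suc r
c-bounds r 1≤r = bounds ((r + 1) / 2) ((r + 1) % 2) (m≡m%n+[m/n]*n (r + 1) 2) (m%n<n (r + 1) 2)
  where
  bounds : ∀ h ρ → r + 1 ≡ ρ + h * 2 → ρ < 2 →
    r ≤ 2 + ((h ∸ 1) + (h ∸ 1)) × 2 + ((h ∸ 1) + (h ∸ 1)) ≤ suc r
  bounds zero ρ r+1≡ρ ρ<2 = ⊥-elim (<-irrefl refl (begin-strict
    1      <⟨ +-monoˡ-≤ 1 1≤r ⟩
    r + 1  ≡⟨ trans r+1≡ρ (+-identityʳ ρ) ⟩
    ρ      ≤⟨ ≤-pred ρ<2 ⟩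
    1      ∎))
    where open ≤-Reasoning
  bounds (suc h) ρ r+1≡ρ+2h ρ<2 = r≤2h , 2h≤1+r
    where
    2h≡ : suc h * 2 ≡ 2 + (h + h)
    2h≡ = cong (2 +_) (trans (*-comm h 2) (cong (h +_) (+-identityʳ h)))
    1+r≡ρ+2h : suc r ≡ ρ + (2 + (h + h))
    1+r≡ρ+2h = trans (+-comm 1 r) (trans r+1≡ρ+2h (cong (ρ +_) 2h≡))
    r≤2h : r ≤ 2 + (h + h)
    r≤2h = +-cancelˡ-≤ 1 r _ (subst (_≤ 1 + (2 + (h + h))) (sym 1+r≡ρ+2h) (+-monoˡ-≤ _ (≤-pred ρ<2)))
    2h≤1+r : 2 + (h + h) ≤ suc r
    2h≤1+r = subst (2 + (h + h) ≤_) (sym 1+r≡ρ+2h) (m≤n+m _ ρ)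

-- In dimension d + 2 we have δ = d/(d+1); clearing the
-- denominator, a point with head sum S and tail sum R lies in B iff (d+1)·S + d·R < d·k.
-- Write k = (S + R) + m with slack m.
inside-B-gap : ∀ d S R m → ¬ (d * ((S + R) + m) ≤ suc d * S + d * R) → S < d * m
inside-B-gap d S R m outside-fails = +-cancelˡ-< (d * S + d * R) S (d * m)
  (subst₂ _<_ (expand-lhs d S R) (expand-rhs d S R m) (≰⇒> outside-fails))
  where
  expand-lhs : ∀ d S R → suc d * S + d * R ≡ (d * S + d * R) + S
  expand-lhs = solve-∀
  expand-rhs : ∀ d S R m → d * ((S + R) + m) ≡ (d * S + d * R) + d * m
  expand-rhs = solve-∀

outside-B-after-raise : ∀ d S R e q R' → q * d ≤ S → R + e ≤ R' →
  d * ((S + R) + (e + q)) ≤ suc d * S + d * R'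
outside-B-after-raise d S R e q R' qd≤S R+e≤R' = begin
  d * ((S + R) + (e + q))          ≡⟨ expand d S R e q ⟩
  (d * S + d * (R + e)) + q * d    ≤⟨ +-monoʳ-≤ (d * S + d * (R + e)) qd≤S ⟩
  (d * S + d * (R + e)) + S        ≡⟨ collect d S (R + e) ⟩
  suc d * S + d * (R + e)          ≤⟨ +-monoʳ-≤ (suc d * S) (*-monoʳ-≤ d R+e≤R') ⟩
  suc d * S + d * R'               ∎
  where
  open ≤-Reasoning
  expand : ∀ d S R e q → d * ((S + R) + (e + q)) ≡ (d * S + d * (R + e)) + q * d
  expand = solve-∀
  collect : ∀ d S R → (d * S + d * R) + S ≡ suc d * S + d * R
  collect = solve-∀

-- The neighbour count of an aligned point inside B: 2m raises on the head, and on each of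
-- the d tail coordinates 2·f lowerings and 2(q+1) raises, where S < (q+1)·d.
aligned-count : ∀ d S R m q → S < suc q * d →
  2 + (((S + R) + m) + ((S + R) + m)) ≤ (m + 0) + ((m + 0) + ((R + d * suc q) + (R + d * suc q)))
aligned-count d S R m q S<[1+q]d = begin
  2 + (((S + R) + m) + ((S + R) + m))  ≡⟨ regroup S R m ⟩
  (suc S + suc S) + ((m + m) + (R + R)) ≤⟨ +-monoˡ-≤ _ (+-mono-≤ S<[1+q]d S<[1+q]d) ⟩
  (suc q * d + suc q * d) + ((m + m) + (R + R)) ≡⟨ rearrange d q R m ⟩
  (m + 0) + ((m + 0) + ((R + d * suc q) + (R + d * suc q))) ∎
  where
  open ≤-Reasoning
  regroup : ∀ S R m → 2 + (((S + R) + m) + ((S + R) + m)) ≡ (suc S + suc S) + ((m + m) + (R + R))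
  regroup = solve-∀
  rearrange : ∀ d q R m →
    (suc q * d + suc q * d) + ((m + m) + (R + R)) ≡ (m + 0) + ((m + 0) + ((R + d * suc q) + (R + d * suc q)))
  rearrange = solve-∀

-- The neighbour count of a misaligned point: exactly 2k + 2.
misaligned-count : ∀ F₀ F₁ R m →
  2 + ((((F₀ + F₁) + R) + m) + (((F₀ + F₁) + R) + m))
    ≡ (F₀ + suc (F₀ + m)) + ((F₁ + suc (F₁ + m)) + (R + R))
misaligned-count = solve-∀

module Percolation (n' d' r : ℕ) (k+k<n' : c r + c r < n') (r≤2k+2 : r ≤ 2 + (c r + c r)) where
  open Moves n' (suc (suc d'))

  k : ℕ
  k = c r

  Vtx : Set
  Vtx = Vertex (suc n') (suc (suc d'))

  Spanned𝒞 : Vtx → Set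
  Spanned𝒞 = Spanned r (CalC r)

  first second : Fin (suc (suc d'))
  first = zero
  second = suc zero

  tail : Fin d' → Fin (suc (suc d'))
  tail j = suc (suc j)

  s12 : Vtx → ℕ
  s12 x = F x first + F x second

  R : Vtx → ℕ
  R x = sumFin d' (λ j → F x (tail j))

  tot : Vtx → ℕ
  tot x = sumFin (suc (suc d')) (F x)

  tot-split : ∀ x → tot x ≡ s12 x + R x
  tot-split x = sym (+-assoc (F x first) (F x second) (R x))

  Aligned : Vtx → Set
  Aligned x = O x first ≡ O x second

  F-half : ∀ x i → F x i + F x i ≤ n'
  F-half x i = fold-half (Finₚ.toℕ≤pred[n] (x i))

  ≤k⇒small : ∀ {v} → v ≤ k → Small v
  ≤k⇒small v≤k = ≤-<-trans (+-mono-≤ v≤k v≤k) k+k<n'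

  tot-move : ∀ x i b {v} → Small v → tot (move x i b v) + F x i ≡ tot x + v
  tot-move x i b small = trans
    (sumFin-exchange _ (F (move x i b _)) (F x) i (λ j j≢i → F-move-elsewhere x i b _ j≢i))
    (cong (tot x +_) (F-move x i b small))

  lowering : ∀ x i b {v} → v < F x i → Small v × v ≢ F x i × tot (move x i b v) < tot x
  lowering x i b {v} v<F = small , <⇒≢ v<F , +-cancelʳ-< (F x i) _ _ decrease
    where
    small : Small v
    small = <-≤-trans (+-mono-< v<F v<F) (F-half x i)
    decrease : tot (move x i b v) + F x i < tot x + F x i
    decrease = subst (_< tot x + F x i) (sym (tot-move x i b small)) (+-monoʳ-< (tot x) v<F)

  module TailMove (x : Vtx) (j : Fin d') (b : Bool) {v : ℕ} (small : Small v) where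
    y : Vtx
    y = move x (tail j) b v

    s12-same : s12 y ≡ s12 x
    s12-same = cong₂ _+_ (F-move-elsewhere x (tail j) b v (λ ())) (F-move-elsewhere x (tail j) b v (λ ()))

    aligned-same : Aligned y ≡ Aligned x
    aligned-same = cong₂ _≡_ (O-move-elsewhere x (tail j) b v (λ ())) (O-move-elsewhere x (tail j) b v (λ ()))

    R-move : R y + F x (tail j) ≡ R x + v
    R-move = trans
      (sumFin-exchange d' (λ j' → F y (tail j')) (λ j' → F x (tail j')) j
        (λ j' j'≢j → F-move-elsewhere x (tail j) b v
                       (λ eq → j'≢j (Finₚ.suc-injective (Finₚ.suc-injective eq)))))
      (cong (R x +_) (F-move x (tail j) b small))

  data Head : Fin (suc (suc d')) → Fin (suc (suc d')) → Set where
    first-second : Head first second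
    second-first : Head second first

  head-split : ∀ {h h'} → Head h h' → ∀ x → s12 x ≡ F x h + F x h'
  head-split first-second x = refl
  head-split second-first x = +-comm (F x first) (F x second)

  partner≢ : ∀ {h h'} → Head h h' → h' ≢ h
  partner≢ first-second ()
  partner≢ second-first ()

  tail≢head : ∀ {h h'} → Head h h' → ∀ j → tail j ≢ h
  tail≢head first-second j ()
  tail≢head second-first j ()

  aligned-from : ∀ {h h'} → Head h h' → ∀ x → O x h ≡ O x h' → Aligned x
  aligned-from first-second x eq = eq
  aligned-from second-first x eq = sym eq

  module HeadMove {h h' : Fin (suc (suc d'))} (head : Head h h') (x : Vtx) (b : Bool) {v : ℕ} (small : Small v) where
    y : Vtx
    y = move x h b v

    s12-move : s12 y ≡ v + F x h'
    s12-move = trans (head-split head y)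
      (cong₂ _+_ (F-move x h b small) (F-move-elsewhere x h b v (partner≢ head)))

    R-same : R y ≡ R x
    R-same = sumFin-cong d' (λ j → F-move-elsewhere x h b v (tail≢head head j))

    tot-y : tot y ≡ (v + F x h') + R x
    tot-y = trans (tot-split y) (cong₂ _+_ s12-move R-same)

    aligned-if-matching : b ≡ O x h' → Aligned y
    aligned-if-matching b≡ = aligned-from head y
      (trans (O-move x h b small) (trans b≡ (sym (O-move-elsewhere x h b v (partner≢ head)))))

  -- An aligned point with tot ≤ k outside B lies in 𝒞 itself: it is the image of its
  -- folded point p ∈ C_r^d under the reflections t = (orientations of x) ∈ T.
  in-𝒞 : ∀ x → Aligned x → tot x ≤ k → d' * k ≤ suc d' * s12 x + d' * R x → CalC r x
  in-𝒞 x aligned tot≤k outside-B = t , t∈T , p , (p∈A , p∉B) , x-is-image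
    where
    p : Vtx
    p i = clamp n' (F x i)

    toℕ-p : ∀ i → toℕ (p i) ≡ F x i
    toℕ-p i = toℕ-clamp n' (≤-trans (m≤m+n _ _) (F-half x i))

    t : Fin (suc (suc d')) → Bool
    t zero = O x first
    t (suc zero) = O x first
    t (suc (suc j)) = O x (tail j)

    t≡O : ∀ i → t i ≡ O x i
    t≡O zero = refl
    t≡O (suc zero) = aligned
    t≡O (suc (suc j)) = refl

    t∈T : InT t
    t∈T zero (suc zero) _ _ = refl
    t∈T zero zero _ ()
    t∈T zero (suc (suc j)) _ ()
    t∈T (suc i) j () _

    x-is-image : ∀ i → toℕ (x i) ≡ reflectCoord (suc n') (t i) (toℕ (p i))
    x-is-image i = sym (trans (cong₂ reflect (t≡O i) (toℕ-p i)) (unfold (Finₚ.toℕ≤pred[n] (x i))))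

    p∈A : Aset r p
    p∈A = subst (_≤ k) (sym (sumFin-cong _ toℕ-p)) tot≤k

    firstTwo-p : firstTwo p ≡ s12 x
    firstTwo-p = begin
      toℕ (p first) + (toℕ (p second) + sumFin d' (λ _ → 0))
        ≡⟨ cong (λ s → toℕ (p first) + (toℕ (p second) + s)) (trans (sumFin-const d' 0) (*-zeroʳ d')) ⟩
      toℕ (p first) + (toℕ (p second) + 0)
        ≡⟨ cong₂ _+_ (toℕ-p first) (trans (+-identityʳ _) (toℕ-p second)) ⟩
      s12 x ∎
      where open ≡-Reasoning

    p∉B : ¬ Bset r p
    p∉B in-B = ≤⇒≯ outside-B
      (subst₂ (λ a b → suc d' * a + d' * b < d' * k) firstTwo-p (sumFin-cong d' (λ j → toℕ-p (tail j))) in-B)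

  aligned-keep : ∀ x i {v} → Small v → Aligned (move x i (O x i) v) ≡ Aligned x
  aligned-keep x i {v} small = cong₂ _≡_ (same-orientation first) (same-orientation second)
    where
    same-orientation : ∀ j → O (move x i (O x i) v) j ≡ O x j
    same-orientation j with j Fin.≟ i
    ... | yes refl = O-move x i (O x i) small
    ... | no j≢i = O-move-elsewhere x i (O x i) v j≢i

  ChangingMove : Vtx → Fin (suc (suc d')) → Bool → ℕ → Set
  ChangingMove x i b v = Small v × v ≢ F x i × Spanned𝒞 (move x i b v)

  as-flips : ∀ x i {vs} → All (ChangingMove x i (not (O x i))) vs → All (FlipMove r (CalC r) x i) vs
  as-flips x i = All.map (λ (small , _ , spanned) → small , spanned)

  slack-split : ∀ x → tot x ≤ k → (s12 x + R x) + (k ∸ tot x) ≡ k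
  slack-split x tot≤k = trans (cong (_+ (k ∸ tot x)) (sym (tot-split x))) (m+[n∸m]≡n tot≤k)

  head-move-total : ∀ {h h'} → Head h h' → ∀ x {v} → tot x ≤ k → v ≤ F x h + (k ∸ tot x) →
    (v + F x h') + R x ≤ k
  head-move-total {h} {h'} head x {v} tot≤k v≤F+m = begin
    (v + F x h') + R x             ≤⟨ +-monoˡ-≤ (R x) (+-monoˡ-≤ (F x h') v≤F+m) ⟩
    ((F x h + m) + F x h') + R x   ≡⟨ regroup (F x h) (F x h') (R x) m ⟩
    ((F x h + F x h') + R x) + m   ≡⟨ cong (λ s → (s + R x) + m) (sym (head-split head x)) ⟩
    (s12 x + R x) + m              ≡⟨ slack-split x tot≤k ⟩
    k                              ∎
    where
    open ≤-Reasoning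
    m : ℕ
    m = k ∸ tot x
    regroup : ∀ a a' R m → ((a + m) + a') + R ≡ ((a + a') + R) + m
    regroup = solve-∀

  head-move-small : ∀ {h h'} → Head h h' → ∀ x {v} → tot x ≤ k → v ≤ F x h + (k ∸ tot x) → Small v
  head-move-small {h' = h'} head x {v} tot≤k v≤F+m =
    ≤k⇒small (≤-trans (≤-trans (m≤m+n v (F x h')) (m≤m+n _ (R x))) (head-move-total head x tot≤k v≤F+m))

  μ : Vtx → ℕ
  μ x = R x + (k ∸ s12 x)

  -- Its spanned neighbours: raising a head
  -- coordinate or lowering a tail coordinate (both decrease μ), and raising a tail
  -- coordinate far enough to leave B, which lands in 𝒞.
  module AlignedInsideB (x : Vtx) (aligned : Aligned x) (tot≤k : tot x ≤ k)
      (inside-B : ¬ (d' * k ≤ suc d' * s12 x + d' * R x))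
      (ih : ∀ y → μ y < μ x → Aligned y → tot y ≤ k → Spanned𝒞 y) where
    S : ℕ
    S = s12 x

    f : Fin d' → ℕ
    f j = F x (tail j)

    m : ℕ
    m = k ∸ tot x

    k≡ : (S + R x) + m ≡ k
    k≡ = slack-split x tot≤k

    S<d'm : S < d' * m
    S<d'm = inside-B-gap d' S (R x) m λ outside →
      inside-B (subst (λ k' → d' * k' ≤ suc d' * S + d' * R x) k≡ outside)

    d'>0 : 0 < d'
    d'>0 = n≢0⇒n>0 λ d'≡0 → n≮0 (subst (λ d'' → S < d'' * m) d'≡0 S<d'm)

    q : ℕ
    q = proj₁ (quotient-bounds S d' d'>0)

    qd'≤S : q * d' ≤ S
    qd'≤S = proj₁ (proj₂ (quotient-bounds S d' d'>0))

    S<[1+q]d' : S < suc q * d'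
    S<[1+q]d' = proj₂ (proj₂ (quotient-bounds S d' d'>0))

    q<m : q < m
    q<m = *-cancelʳ-< d' q m (≤-<-trans qd'≤S (subst (S <_) (*-comm d' m) S<d'm))

    -- a tail coordinate raised by at least e leaves B
    e : ℕ
    e = m ∸ q

    e+q≡m : e + q ≡ m
    e+q≡m = m∸n+n≡m (<⇒≤ q<m)

    tail-moves : Fin d' → List ℕ
    tail-moves j = interval 0 (f j) ++ interval (f j + e) (suc q)

    keep flip : Fin (suc (suc d')) → List ℕ
    keep zero = interval (suc (F x first)) m
    keep (suc zero) = interval (suc (F x second)) m
    keep (suc (suc j)) = tail-moves j
    flip zero = []
    flip (suc zero) = []
    flip (suc (suc j)) = tail-moves j

    tail-moves-unique : ∀ j → Unique (tail-moves j)
    tail-moves-unique j = Uniqueₚ.++⁺ (unique-interval 0 (f j)) (unique-interval (f j + e) (suc q))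
      (disjoint-intervals 0 (f j) (f j + e) (suc q) (m≤m+n (f j) e))

    keep-unique : ∀ i → Unique (keep i)
    keep-unique zero = unique-interval _ m
    keep-unique (suc zero) = unique-interval _ m
    keep-unique (suc (suc j)) = tail-moves-unique j

    flip-unique : ∀ i → Unique (flip i)
    flip-unique zero = []
    flip-unique (suc zero) = []
    flip-unique (suc (suc j)) = tail-moves-unique j

    head-raise : ∀ {h h'} → Head h h' → ∀ v → suc (F x h) ≤ v → v < suc (F x h) + m →
      ChangingMove x h (O x h) v
    head-raise {h} {h'} head v F<v v<1+F+m = small , (λ v≡F → <-irrefl (sym v≡F) F<v) ,
      ih y μy<μx (subst id (sym (aligned-keep x h small)) aligned) tot-y≤k
      where
      raised-sum≤k : (v + F x h') + R x ≤ k
      raised-sum≤k = head-move-total head x tot≤k (≤-pred v<1+F+m)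
      small : Small v
      small = head-move-small head x tot≤k (≤-pred v<1+F+m)
      open HeadMove head x (O x h) {v} small
      tot-y≤k : tot y ≤ k
      tot-y≤k = subst (_≤ k) (sym tot-y) raised-sum≤k
      μy<μx : μ y < μ x
      μy<μx = begin-strict
        R y + (k ∸ s12 y)                ≡⟨ cong₂ (λ a s → a + (k ∸ s)) R-same s12-move ⟩
        R x + (k ∸ (v + F x h'))         <⟨ +-monoʳ-< (R x) (∸-monoʳ-< (+-monoˡ-< (F x h') F<v)
                                              (≤-trans (m≤m+n _ (R x)) raised-sum≤k)) ⟩
        R x + (k ∸ (F x h + F x h'))     ≡⟨ cong (λ s → R x + (k ∸ s)) (sym (head-split head x)) ⟩
        μ x                              ∎
        where open ≤-Reasoning

    tail-lower : ∀ j b v → v < f j → ChangingMove x (tail j) b v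
    tail-lower j b v v<f with small , v≢f , tot-y<tot-x ← lowering x (tail j) b v<f =
      small , v≢f , ih y μy<μx (subst id (sym aligned-same) aligned)
                      (≤-trans (<⇒≤ tot-y<tot-x) tot≤k)
      where
      open TailMove x j b {v} small
      Ry<Rx : R y < R x
      Ry<Rx = +-cancelʳ-< (f j) (R y) (R x) (subst (_< R x + f j) (sym R-move) (+-monoʳ-< (R x) v<f))
      μy<μx : μ y < μ x
      μy<μx = subst (λ s → R y + (k ∸ s) < μ x) (sym s12-same) (+-monoˡ-< (k ∸ S) Ry<Rx)

    tail-raise : ∀ j b v → f j + e ≤ v → v < (f j + e) + suc q → ChangingMove x (tail j) b v
    tail-raise j b v f+e≤v v<f+e+1+q = small , (λ v≡f → <-irrefl (sym v≡f) f<v) ,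
      0 , in-𝒞 y (subst id (sym aligned-same) aligned) tot-y≤k outside-B-y
      where
      v≤f+m : v ≤ f j + m
      v≤f+m = subst (v ≤_) (trans (+-assoc (f j) e q) (cong (f j +_) e+q≡m))
        (≤-pred (subst (v <_) (+-suc (f j + e) q) v<f+e+1+q))
      f<v : f j < v
      f<v = <-≤-trans (subst (_< f j + e) (+-identityʳ (f j)) (+-monoʳ-< (f j) (m<n⇒0<n∸m q<m))) f+e≤v
      R+m≤k : R x + m ≤ k
      R+m≤k = subst (R x + m ≤_) k≡ (+-monoˡ-≤ m (m≤n+m (R x) S))
      small : Small v
      small = ≤k⇒small (≤-trans v≤f+m (≤-trans (+-monoˡ-≤ m (term≤sumFin d' f j)) R+m≤k))
      open TailMove x j b {v} small
      Rx+e≤Ry : R x + e ≤ R y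
      Rx+e≤Ry = +-cancelʳ-≤ (f j) (R x + e) (R y) (begin
        (R x + e) + f j  ≡⟨ trans (+-assoc (R x) e (f j)) (cong (R x +_) (+-comm e (f j))) ⟩
        R x + (f j + e)  ≤⟨ +-monoʳ-≤ (R x) f+e≤v ⟩
        R x + v          ≡⟨ sym R-move ⟩
        R y + f j        ∎)
        where open ≤-Reasoning
      Ry≤Rx+m : R y ≤ R x + m
      Ry≤Rx+m = +-cancelʳ-≤ (f j) (R y) (R x + m) (begin
        R y + f j        ≡⟨ R-move ⟩
        R x + v          ≤⟨ +-monoʳ-≤ (R x) v≤f+m ⟩
        R x + (f j + m)  ≡⟨ trans (cong (R x +_) (+-comm (f j) m)) (sym (+-assoc (R x) m (f j))) ⟩
        (R x + m) + f j  ∎)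
        where open ≤-Reasoning
      tot-y≤k : tot y ≤ k
      tot-y≤k = begin
        tot y            ≡⟨ trans (tot-split y) (cong (_+ R y) s12-same) ⟩
        S + R y          ≤⟨ +-monoʳ-≤ S Ry≤Rx+m ⟩
        S + (R x + m)    ≡⟨ sym (+-assoc S (R x) m) ⟩
        (S + R x) + m    ≡⟨ k≡ ⟩
        k                ∎
        where open ≤-Reasoning
      outside-B-y : d' * k ≤ suc d' * s12 y + d' * R y
      outside-B-y = subst₂ (λ k' s → d' * k' ≤ suc d' * s + d' * R y)
        (trans (cong ((S + R x) +_) e+q≡m) k≡) (sym s12-same)
        (outside-B-after-raise d' S (R x) e q (R y) qd'≤S Rx+e≤Ry)

    tail-ok : ∀ j b → All (ChangingMove x (tail j) b) (tail-moves j)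
    tail-ok j b = Allₚ.++⁺ (all-interval 0 (f j) (λ v _ v<f → tail-lower j b v v<f))
                           (all-interval (f j + e) (suc q) (tail-raise j b))

    keep-ok : ∀ i → All (KeepMove r (CalC r) x i) (keep i)
    keep-ok zero = all-interval _ m (head-raise first-second)
    keep-ok (suc zero) = all-interval _ m (head-raise second-first)
    keep-ok (suc (suc j)) = tail-ok j (O x (tail j))

    flip-ok : ∀ i → All (FlipMove r (CalC r) x i) (flip i)
    flip-ok zero = []
    flip-ok (suc zero) = []
    flip-ok (suc (suc j)) = as-flips x (tail j) (tail-ok j (not (O x (tail j))))

    tail-count : sumFin d' (λ j → length (tail-moves j) + length (tail-moves j))
                 ≡ (R x + d' * suc q) + (R x + d' * suc q)
    tail-count = trans (sumFin-+ d' _ _) (cong₂ _+_ one-side one-side)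
      where
      one-side : sumFin d' (λ j → length (tail-moves j)) ≡ R x + d' * suc q
      one-side = trans
        (sumFin-cong d' λ j → trans (length-++ (interval 0 (f j)))
          (cong₂ _+_ (length-interval 0 (f j)) (length-interval (f j + e) (suc q))))
        (sumFin-shift d' f (suc q))

    count : r ≤ sumFin (suc (suc d')) (λ i → length (keep i) + length (flip i))
    count = begin
      r                                          ≤⟨ r≤2k+2 ⟩
      2 + (k + k)                                ≡⟨ cong (λ k' → 2 + (k' + k')) (sym k≡) ⟩
      2 + (((S + R x) + m) + ((S + R x) + m))   ≤⟨ aligned-count d' S (R x) m q S<[1+q]d' ⟩
      (m + 0) + ((m + 0) + ((R x + d' * suc q) + (R x + d' * suc q)))
        ≡⟨ sym (cong₂ _+_ (cong (_+ 0) (length-interval _ m))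
                 (cong₂ _+_ (cong (_+ 0) (length-interval _ m)) tail-count)) ⟩
      sumFin (suc (suc d')) (λ i → length (keep i) + length (flip i)) ∎
      where open ≤-Reasoning

    spanned-x : Spanned𝒞 x
    spanned-x = spanned-by-moves r (CalC r) x keep flip keep-unique flip-unique keep-ok flip-ok count

  aligned-spanned : ∀ x → Acc _<_ (μ x) → Aligned x → tot x ≤ k → Spanned𝒞 x
  aligned-spanned x (acc smaller) aligned tot≤k with d' * k ≤? suc d' * s12 x + d' * R x
  ... | yes outside-B = 0 , in-𝒞 x aligned tot≤k outside-B
  ... | no inside-B = AlignedInsideB.spanned-x x aligned tot≤k inside-B
                        λ y μy<μx → aligned-spanned y (smaller μy<μx)

  -- Lowering a coordinate keeps the point misaligned
  -- when the orientation is kept (or a tail one is flipped), and moving a head coordinate to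
  -- its partner's orientation, at any value ≤ F x h + slack, gives an aligned point with
  -- total ≤ k.
  module Misaligned (x : Vtx) (misaligned : ¬ Aligned x) (tot≤k : tot x ≤ k)
      (ih : ∀ y → tot y < tot x → ¬ Aligned y → tot y ≤ k → Spanned𝒞 y) where
    f : Fin d' → ℕ
    f j = F x (tail j)

    m : ℕ
    m = k ∸ tot x

    lower : Fin (suc (suc d')) → List ℕ
    lower i = interval 0 (F x i)

    flip : Fin (suc (suc d')) → List ℕ
    flip zero = interval 0 (suc (F x first + m))
    flip (suc zero) = interval 0 (suc (F x second + m))
    flip (suc (suc j)) = lower (tail j)

    flip-unique : ∀ i → Unique (flip i)
    flip-unique zero = unique-interval 0 _
    flip-unique (suc zero) = unique-interval 0 _
    flip-unique (suc (suc j)) = unique-interval 0 _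

    descend : ∀ i b v → v < F x i → (Small v → Aligned (move x i b v) ≡ Aligned x) → ChangingMove x i b v
    descend i b v v<F same-alignment with small , v≢F , tot-y<tot-x ← lowering x i b v<F =
      small , v≢F , ih _ tot-y<tot-x
        (λ aligned-y → misaligned (subst id (same-alignment small) aligned-y))
        (≤-trans (<⇒≤ tot-y<tot-x) tot≤k)

    head-flip : ∀ {h h'} → Head h h' → ∀ v → v < suc (F x h + m) → FlipMove r (CalC r) x h v
    head-flip {h} {h'} head v v<1+F+m = small , aligned-spanned y (<-wellFounded (μ y)) aligned-y tot-y≤k
      where
      small : Small v
      small = head-move-small head x tot≤k (≤-pred v<1+F+m)
      open HeadMove head x (not (O x h)) {v} small
      aligned-y : Aligned y
      aligned-y = aligned-if-matching (sym (¬-not λ O'≡O → misaligned (aligned-from head x (sym O'≡O))))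
      tot-y≤k : tot y ≤ k
      tot-y≤k = subst (_≤ k) (sym tot-y) (head-move-total head x tot≤k (≤-pred v<1+F+m))

    keep-ok : ∀ i → All (KeepMove r (CalC r) x i) (lower i)
    keep-ok i = all-interval 0 (F x i) λ v _ v<F → descend i (O x i) v v<F (aligned-keep x i)

    flip-ok : ∀ i → All (FlipMove r (CalC r) x i) (flip i)
    flip-ok zero = all-interval 0 _ λ v _ → head-flip first-second v
    flip-ok (suc zero) = all-interval 0 _ λ v _ → head-flip second-first v
    flip-ok (suc (suc j)) = as-flips x (tail j) (all-interval 0 (f j) λ v _ v<f →
      descend (tail j) (not (O x (tail j))) v v<f (λ small → TailMove.aligned-same x j (not (O x (tail j))) {v} small))

    head-count : ∀ h → length (lower h) + length (interval 0 (suc (F x h + m))) ≡ F x h + suc (F x h + m)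
    head-count h = cong₂ _+_ (length-interval 0 (F x h)) (length-interval 0 _)

    tail-count : sumFin d' (λ j → length (lower (tail j)) + length (lower (tail j))) ≡ R x + R x
    tail-count = trans (sumFin-cong d' (λ j → cong₂ _+_ (length-interval 0 (f j)) (length-interval 0 (f j))))
                       (sumFin-+ d' f f)

    count : r ≤ sumFin (suc (suc d')) (λ i → length (lower i) + length (flip i))
    count = begin
      r                                                         ≤⟨ r≤2k+2 ⟩
      2 + (k + k)
        ≡⟨ cong (λ k' → 2 + (k' + k')) (sym (slack-split x tot≤k)) ⟩
      2 + (((s12 x + R x) + m) + ((s12 x + R x) + m))           ≡⟨ misaligned-count (F x first) (F x second) (R x) m ⟩
      (F x first + suc (F x first + m)) + ((F x second + suc (F x second + m)) + (R x + R x))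
        ≡⟨ sym (cong₂ _+_ (head-count first) (cong₂ _+_ (head-count second) tail-count)) ⟩
      sumFin (suc (suc d')) (λ i → length (lower i) + length (flip i)) ∎
      where open ≤-Reasoning

    spanned-x : Spanned𝒞 x
    spanned-x = spanned-by-moves r (CalC r) x lower flip (λ i → unique-interval 0 (F x i))
                  flip-unique keep-ok flip-ok count

  misaligned-spanned : ∀ x → Acc _<_ (tot x) → ¬ Aligned x → tot x ≤ k → Spanned𝒞 x
  misaligned-spanned x (acc smaller) misaligned tot≤k =
    Misaligned.spanned-x x misaligned tot≤k λ y tot-y<tot-x → misaligned-spanned y (smaller tot-y<tot-x)

  -- Every point is spanned, by induction on tot: points with tot ≤ k are handled above, and
  -- a point with tot > k has the 2·tot ≥ 2k + 2 lowerings as spanned neighbours.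
  spanned : ∀ x → Acc _<_ (tot x) → Spanned𝒞 x
  spanned x (acc smaller) with tot x ≤? k
  ... | yes tot≤k with O x first Boolₚ.≟ O x second
  ...   | yes aligned = aligned-spanned x (<-wellFounded (μ x)) aligned tot≤k
  ...   | no misaligned = misaligned-spanned x (<-wellFounded (tot x)) misaligned tot≤k
  spanned x (acc smaller) | no tot≰k =
    spanned-by-moves r (CalC r) x lower lower unique unique lower-keep lower-flip count
    where
    lower : Fin (suc (suc d')) → List ℕ
    lower i = interval 0 (F x i)

    unique : ∀ i → Unique (lower i)
    unique i = unique-interval 0 (F x i)

    length-lower : ∀ i → length (lower i) + length (lower i) ≡ F x i + F x i
    length-lower i = cong₂ _+_ (length-interval 0 (F x i)) (length-interval 0 (F x i))

    lower-with : ∀ i b → All (ChangingMove x i b) (lower i)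
    lower-with i b = all-interval 0 (F x i) λ v _ v<F →
      let small , v≢F , tot-y<tot-x = lowering x i b v<F in small , v≢F , spanned _ (smaller tot-y<tot-x)

    lower-keep : ∀ i → All (KeepMove r (CalC r) x i) (lower i)
    lower-keep i = lower-with i (O x i)

    lower-flip : ∀ i → All (FlipMove r (CalC r) x i) (lower i)
    lower-flip i = as-flips x i (lower-with i (not (O x i)))

    count : r ≤ sumFin (suc (suc d')) (λ i → length (lower i) + length (lower i))
    count = begin
      r                     ≤⟨ r≤2k+2 ⟩
      2 + (k + k)           ≡⟨ cong suc (sym (+-suc k k)) ⟩
      suc k + suc k         ≤⟨ +-mono-≤ (≰⇒> tot≰k) (≰⇒> tot≰k) ⟩
      tot x + tot x         ≡⟨ sym (trans (sumFin-cong _ length-lower) (sumFin-+ _ (F x) (F x))) ⟩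
      sumFin (suc (suc d')) (λ i → length (lower i) + length (lower i)) ∎
      where open ≤-Reasoning

  percolates : Percolates {suc n'} {suc (suc d')} r (CalC r)
  percolates x = spanned x (<-wellFounded (tot x))

lemma4p2 : (n r d : ℕ) → 1 ≤ n → 1 ≤ r → 1 ≤ d → r + 1 ≤ n → 2 ≤ d →
    Percolates {n} {d} r (CalC r)
lemma4p2 (suc n') r (suc (suc d')) _ 1≤r _ r+1≤n _ = Percolation.percolates n' d' r k+k<n' r≤2k+2
  where
  r≤2k+2 : r ≤ 2 + (c r + c r)
  r≤2k+2 = proj₁ (c-bounds r 1≤r)
  k+k<n' : c r + c r < n'
  k+k<n' = ≤-pred (≤-trans (proj₂ (c-bounds r 1≤r)) (subst (_≤ suc n') (+-comm r 1) r+1≤n))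
lemma4p2 (suc n') r (suc zero) _ _ _ _ (s≤s ())
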